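{- Let $\{[\mathcal{Q}_i,\mathcal{QV}_i,M_i]\}_{i<\varphi}$ be a computation with $\mathrm{Q}(M_0)=\emptyset$ and $\mathcal{QV}_0=\emptyset$. Then for every $i<\varphi$, $\mathcal{QV}_i=\mathrm{Q}(M_i)$.
   Context: The Q-calculus. Terms: classical variables $x$; quantum variables $r$; patterns $\pi::=x\mid\langle x_1,\dots,x_n\rangle$; constants $0,1$ and symbols $U_i$ for a fixed effective enumeration $(\mathbf{U}_i)$ of computable unitary operators on $\mathbb{C}^{2^{n_i}}$; terms $M::=x\mid r\mid\ !M\mid C\mid \mathtt{new}(M)\mid (M_1)M_2\mid\langle M_1,\dots,M_n\rangle\ (n\ge2)\mid \lambda!x.M\mid\lambda\pi.M$ modulo $\alpha$-conversion. $\mathrm{Q}(M)$ is the set of quantum variables occurring in $M$. Well-formedness of judgements $\Gamma\vdash M$ is given by the linear-logic-style rules of the calculus (axioms $\vdash C$, $r\vdash r$, $x\vdash x$; weakening and contraction on $!x$; promotion $!\Gamma\vdash M\Rightarrow !\Gamma\vdash!M$; dereliction $\Gamma,x\vdash M\Rightarrow\Gamma,!x\vdash M$; pattern and tuple rules; $\mathtt{new}$; abstraction rules for $\lambda\pi$ and $\lambda!x$; multiplicative application rule). For a finite set $V$ of quantum variables, $\mathcal{H}(V)$ is the Hilbert space of functions $\{0,1\}^V\to\mathbb{C}$; a configuration $[\mathcal{Q},\mathcal{QV},M]$ has $\mathcal{QV}$ a finite set of quantum variables, $\mathcal{Q}\in\mathcal{H}(\mathcal{QV})$, $\mathrm{Q}(M)\subseteq\mathcal{QV}$,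 considered modulo bijective renaming of quantum variables, and is well formed if $\Gamma\vdash M$ is well formed for some $\Gamma$. Reduction $\to$ on well-formed configurations: ($\mathsf{Uq}$) $[\mathcal{Q},\mathcal{QV},U\langle r_1,\dots,r_n\rangle]\to[\mathbf{U}_{\langle\langle r_1,\dots,r_n\rangle\rangle}\mathcal{Q},\mathcal{QV},\langle r_1,\dots,r_n\rangle]$ (apply $\mathbf{U}$ to qubits $r_1,\dots,r_n$); ($\mathsf{new}$) $[\mathcal{Q},\mathcal{QV},\mathtt{new}(c)]\to[\mathcal{Q}\otimes|r\mapsto c\rangle,\mathcal{QV}\cup\{r\},r]$ with $c\in\{0,1\}$, $r$ fresh; and, leaving $\mathcal{Q},\mathcal{QV}$ unchanged, $(\lambda x.M)N\to M\{N/x\}$, $(\lambda\langle x_1,\dots,x_n\rangle.M)\langle r_1,\dots,r_n\rangle\to M\{r_i/x_i\}_i$, $(\lambda!x.M)!N\to M\{N/x\}$, $L((\lambda\pi.M)N)\to(\lambda\pi.LM)N$, $((\lambda\pi.M)N)L\to(\lambda\pi.ML)N$; closed under tuple components, both sides of application, and the body of $\lambda\pi.(\cdot)$. A configuration is in normal form if it has no reduct. A computation of length $\varphi\le\omega$ is a sequence of configurations $\{C_i\}_{i<\varphi}$ with $C_{i-1}\to C_i$ for all $0<i<\varphi$, and either $\varphi=\omega$ or the last configuration is in normal form. -}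

module Defs where

open import Data.Nat using (ℕ; zero; suc; _+_; _<_)
open import Data.Bool using (Bool; true; false)
open import Data.Maybe using (Maybe; just; nothing)
open import Data.List using (List; []; _∷_; _++_; length; map)
open import Data.List.Membership.Propositional using (_∈_; _∉_)
open import Data.Product using (Σ; _×_; ∃; _,_)
open import Data.Unit using (⊤)
open import Relation.Nullary using (¬_)
open import Relation.Binary.PropositionalEquality using (_≡_; _≢_)
open import Function.Bundles using (_⇔_)

-- Classical variables are de Bruijn indices (this realises "modulo
-- α-conversion").  Quantum variables are names r : ℕ (never bound).
-- Convention for the binder λ⟨x₁,…,xₙ⟩.M : inside M, index (i-1) refers
-- to xᵢ (1 ≤ i ≤ n), and index n+j refers to the outer index j.

data Term : Set where
  var  : ℕ → Term
  qvar : ℕ → Term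
  bang : Term → Term
  c0   : Term
  c1   : Term
  U    : ℕ → Term
  new  : Term → Term
  app  : Term → Term → Term
  tup  : Term → Term → List Term → Term   -- ⟨M₁,M₂,M₃…,Mₙ⟩  (n ≥ 2)
  lamB : Term → Term
  lamV : Term → Term
  lamT : ℕ → Term → Term                  -- λ⟨x₁,…,x_{2+k}⟩.M

mutual
  Q : Term → List ℕ
  Q (var x) = []
  Q (qvar r) = r ∷ []
  Q (bang M) = Q M
  Q c0 = []
  Q c1 = []
  Q (U i) = []
  Q (new M) = Q M
  Q (app M N) = Q M ++ Q N
  Q (tup M N Ms) = Q M ++ Q N ++ Qs Ms
  Q (lamB M) = Q M
  Q (lamV M) = Q M
  Q (lamT k M) = Q M

  Qs : List Term → List ℕ
  Qs [] = []
  Qs (M ∷ Ms) = Q M ++ Qs Ms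

ext : (ℕ → ℕ) → ℕ → ℕ
ext ρ zero = zero
ext ρ (suc n) = suc (ρ n)

extN : ℕ → (ℕ → ℕ) → ℕ → ℕ
extN zero ρ = ρ
extN (suc k) ρ = ext (extN k ρ)

mutual
  rename : (ℕ → ℕ) → Term → Term
  rename ρ (var x) = var (ρ x)
  rename ρ (qvar r) = qvar r
  rename ρ (bang M) = bang (rename ρ M)
  rename ρ c0 = c0
  rename ρ c1 = c1
  rename ρ (U i) = U i
  rename ρ (new M) = new (rename ρ M)
  rename ρ (app M N) = app (rename ρ M) (rename ρ N)
  rename ρ (tup M N Ms) = tup (rename ρ M) (rename ρ N) (renames ρ Ms)
  rename ρ (lamB M) = lamB (rename (ext ρ) M)
  rename ρ (lamV M) = lamV (rename (ext ρ) M)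
  rename ρ (lamT k M) = lamT k (rename (extN (suc (suc k)) ρ) M)

  renames : (ℕ → ℕ) → List Term → List Term
  renames ρ [] = []
  renames ρ (M ∷ Ms) = rename ρ M ∷ renames ρ Ms

wk : ℕ → Term → Term
wk b = rename (b +_)

exts : (ℕ → Term) → ℕ → Term
exts σ zero = var zero
exts σ (suc n) = wk 1 (σ n)

extsN : ℕ → (ℕ → Term) → ℕ → Term
extsN zero σ = σ
extsN (suc k) σ = exts (extsN k σ)

mutual
  subst : (ℕ → Term) → Term → Term
  subst σ (var x) = σ x
  subst σ (qvar r) = qvar r
  subst σ (bang M) = bang (subst σ M)
  subst σ c0 = c0
  subst σ c1 = c1
  subst σ (U i) = U i
  subst σ (new M) = new (subst σ M)
  subst σ (app M N) = app (subst σ M) (subst σ N)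
  subst σ (tup M N Ms) = tup (subst σ M) (subst σ N) (substs σ Ms)
  subst σ (lamB M) = lamB (subst (exts σ) M)
  subst σ (lamV M) = lamV (subst (exts σ) M)
  subst σ (lamT k M) = lamT k (subst (extsN (suc (suc k)) σ) M)

  substs : (ℕ → Term) → List Term → List Term
  substs σ [] = []
  substs σ (M ∷ Ms) = subst σ M ∷ substs σ Ms

sub0 : Term → ℕ → Term
sub0 N zero = N
sub0 N (suc n) = var n

_[_] : Term → Term → Term
M [ N ] = subst (sub0 N) M

patSub : List ℕ → ℕ → Term
patSub [] n = var n
patSub (r ∷ rs) zero = qvar r
patSub (r ∷ rs) (suc n) = patSub rs n

data QTup : List ℕ → Term → Set where
  one  : ∀ r → QTup (r ∷ []) (qvar r)
  many : ∀ r₁ r₂ rs → QTup (r₁ ∷ r₂ ∷ rs) (tup (qvar r₁) (qvar r₂) (map qvar rs))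

-- Well-formedness judgements Γ ⊢ M (linear-logic style).
-- A context assigns to each free classical de Bruijn index: absent,
-- x (linear) or !x, and to each quantum variable: absent / present.

data Hyp : Set where
  lin bng : Hyp

record Ctx : Set where
  constructor ctx
  field
    cl : ℕ → Maybe Hyp
    qv : ℕ → Bool
open Ctx public

-- entries allowed in a context of the form !Δ
data Unr : Maybe Hyp → Set where
  none : Unr nothing
  bngd : Unr (just bng)

Banged : Ctx → Set
Banged Γ = (∀ n → Unr (cl Γ n)) × (∀ r → qv Γ r ≡ false)

-- Γ = Γ₁,Γ₂ ; !x may be shared by both (contraction)
data SplitH : Maybe Hyp → Maybe Hyp → Maybe Hyp → Set where
  nn  : SplitH nothing nothing nothing
  ll  : SplitH (just lin) (just lin) nothing
  lr  : SplitH (just lin) nothing (just lin)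
  bl  : SplitH (just bng) (just bng) nothing
  br  : SplitH (just bng) nothing (just bng)
  bb  : SplitH (just bng) (just bng) (just bng)

data SplitQ : Bool → Bool → Bool → Set where
  nn : SplitQ false false false
  l  : SplitQ true true false
  r  : SplitQ true false true

Split : Ctx → Ctx → Ctx → Set
Split Γ Γ₁ Γ₂ = (∀ n → SplitH (cl Γ n) (cl Γ₁ n) (cl Γ₂ n))
              × (∀ q → SplitQ (qv Γ q) (qv Γ₁ q) (qv Γ₂ q))

extend : Maybe Hyp → Ctx → Ctx
extend h Γ = ctx f (qv Γ)
  where
  f : ℕ → Maybe Hyp
  f zero = h
  f (suc n) = cl Γ n

extendN : ℕ → Maybe Hyp → Ctx → Ctx
extendN zero h Γ = Γ
extendN (suc k) h Γ = extend h (extendN k h Γ)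

data IsConst : Term → Set where
  k0 : IsConst c0
  k1 : IsConst c1
  kU : ∀ i → IsConst (U i)

mutual
  data _⊢_ : Ctx → Term → Set where
    -- ⊢ C, with weakening on !x absorbed
    axC  : ∀ {Γ C} → Banged Γ → IsConst C → Γ ⊢ C
    axQ  : ∀ {Γ r} → (∀ n → Unr (cl Γ n)) → qv Γ r ≡ true
         → (∀ s → s ≢ r → qv Γ s ≡ false) → Γ ⊢ qvar r
    -- x ⊢ x  and (by dereliction) !x ⊢ x
    axX  : ∀ {Γ n h} → cl Γ n ≡ just h → (∀ m → m ≢ n → Unr (cl Γ m))
         → (∀ s → qv Γ s ≡ false) → Γ ⊢ var n
    prom : ∀ {Γ M} → Banged Γ → Γ ⊢ M → Γ ⊢ bang M
    wnew : ∀ {Γ M} → Γ ⊢ M → Γ ⊢ new M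
    wapp : ∀ {Γ Γ₁ Γ₂ M N} → Split Γ Γ₁ Γ₂ → Γ₁ ⊢ M → Γ₂ ⊢ N → Γ ⊢ app M N
    wtup : ∀ {Γ Γ₁ Γ₂ M N Ms} → Split Γ Γ₁ Γ₂ → Γ₁ ⊢ M → Γ₂ ⊢* (N ∷ Ms)
         → Γ ⊢ tup M N Ms
    wlamB : ∀ {Γ M} → extend (just bng) Γ ⊢ M → Γ ⊢ lamB M
    wlamV : ∀ {Γ M} → extend (just lin) Γ ⊢ M → Γ ⊢ lamV M
    wlamT : ∀ {Γ k M} → extendN (suc (suc k)) (just lin) Γ ⊢ M → Γ ⊢ lamT k M

  data _⊢*_ : Ctx → List Term → Set where
    wnil  : ∀ {Γ} → Banged Γ → Γ ⊢* []
    wcons : ∀ {Γ Γ₁ Γ₂ M Ms} → Split Γ Γ₁ Γ₂ → Γ₁ ⊢ M → Γ₂ ⊢* Ms → Γ ⊢* (M ∷ Ms)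

WFTerm : Term → Set
WFTerm M = ∃ λ Γ → Γ ⊢ M

-- Abstract model of the quantum register.
-- arity i = nᵢ (Uᵢ acts on ℂ^{2^{nᵢ}}); State QV plays H(QV);
-- applyU applies Uᵢ to the listed qubits; extend-state is Q ⊗ |r ↦ c⟩.

record QModel : Set₁ where
  field
    arity   : ℕ → ℕ
    State   : List ℕ → Set
    applyU  : (i : ℕ) (QV : List ℕ) (rs : List ℕ) → State QV → State QV
    tensor  : (QV : List ℕ) (r : ℕ) → Bool → State QV → State (r ∷ QV)

bit : Bool → Term
bit false = c0
bit true = c1

module QC (QM : QModel) where
  open QModel QM

  record Conf : Set where
    constructor ⟨_,_,_⟩
    field
      QV : List ℕ
      st : State QV
      tm : Term
  open Conf public

  WFConf : Conf → Set
  WFConf C = (∀ r → r ∈ Q (tm C) → r ∈ QV C) × WFTerm (tm C)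

  infix 4 _⟶_
  data _⟶_ : Conf → Conf → Set where
    Uq    : ∀ {QV st i rs t} → length rs ≡ arity i → QTup rs t
          → ⟨ QV , st , app (U i) t ⟩ ⟶ ⟨ QV , applyU i QV rs st , t ⟩
    rnew  : ∀ {QV st c r} → r ∉ QV
          → ⟨ QV , st , new (bit c) ⟩ ⟶ ⟨ r ∷ QV , tensor QV r c st , qvar r ⟩
    βV    : ∀ {QV st M N} → ⟨ QV , st , app (lamV M) N ⟩ ⟶ ⟨ QV , st , M [ N ] ⟩
    βT    : ∀ {QV st k M rs t} → length rs ≡ suc (suc k) → QTup rs t
          → ⟨ QV , st , app (lamT k M) t ⟩ ⟶ ⟨ QV , st , subst (patSub rs) M ⟩
    βB    : ∀ {QV st M N} → ⟨ QV , st , app (lamB M) (bang N) ⟩ ⟶ ⟨ QV , st , M [ N ] ⟩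
    ccLV  : ∀ {QV st L M N}
          → ⟨ QV , st , app L (app (lamV M) N) ⟩ ⟶ ⟨ QV , st , app (lamV (app (wk 1 L) M)) N ⟩
    ccLT  : ∀ {QV st k L M N}
          → ⟨ QV , st , app L (app (lamT k M) N) ⟩
            ⟶ ⟨ QV , st , app (lamT k (app (wk (suc (suc k)) L) M)) N ⟩
    ccRV  : ∀ {QV st L M N}
          → ⟨ QV , st , app (app (lamV M) N) L ⟩ ⟶ ⟨ QV , st , app (lamV (app M (wk 1 L))) N ⟩
    ccRT  : ∀ {QV st k L M N}
          → ⟨ QV , st , app (app (lamT k M) N) L ⟩
            ⟶ ⟨ QV , st , app (lamT k (app M (wk (suc (suc k)) L))) N ⟩
    appL  : ∀ {QV st QV' st' M M' N} → ⟨ QV , st , M ⟩ ⟶ ⟨ QV' , st' , M' ⟩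
          → ⟨ QV , st , app M N ⟩ ⟶ ⟨ QV' , st' , app M' N ⟩
    appR  : ∀ {QV st QV' st' M N N'} → ⟨ QV , st , N ⟩ ⟶ ⟨ QV' , st' , N' ⟩
          → ⟨ QV , st , app M N ⟩ ⟶ ⟨ QV' , st' , app M N' ⟩
    tup1  : ∀ {QV st QV' st' M M' N Ms} → ⟨ QV , st , M ⟩ ⟶ ⟨ QV' , st' , M' ⟩
          → ⟨ QV , st , tup M N Ms ⟩ ⟶ ⟨ QV' , st' , tup M' N Ms ⟩
    tup2  : ∀ {QV st QV' st' M N N' Ms} → ⟨ QV , st , N ⟩ ⟶ ⟨ QV' , st' , N' ⟩
          → ⟨ QV , st , tup M N Ms ⟩ ⟶ ⟨ QV' , st' , tup M N' Ms ⟩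
    tup3  : ∀ {QV st QV' st' M N P P' pre post} → ⟨ QV , st , P ⟩ ⟶ ⟨ QV' , st' , P' ⟩
          → ⟨ QV , st , tup M N (pre ++ P ∷ post) ⟩ ⟶ ⟨ QV' , st' , tup M N (pre ++ P' ∷ post) ⟩
    lamVξ : ∀ {QV st QV' st' M M'} → ⟨ QV , st , M ⟩ ⟶ ⟨ QV' , st' , M' ⟩
          → ⟨ QV , st , lamV M ⟩ ⟶ ⟨ QV' , st' , lamV M' ⟩
    lamTξ : ∀ {QV st QV' st' k M M'} → ⟨ QV , st , M ⟩ ⟶ ⟨ QV' , st' , M' ⟩
          → ⟨ QV , st , lamT k M ⟩ ⟶ ⟨ QV' , st' , lamT k M' ⟩

  _→Q_ : Conf → Conf → Set
  C →Q C' = WFConf C × WFConf C' × (C ⟶ C')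

  Normal : Conf → Set
  Normal C = ∀ C' → ¬ (C →Q C')

  data Len : Set where
    fin   : ℕ → Len
    omega : Len

  _<φ_ : ℕ → Len → Set
  i <φ fin n = i < n
  i <φ omega = ⊤

  record Computation : Set where
    field
      φ     : Len
      conf  : ℕ → Conf               -- Cᵢ, meaningful for i < φ
      wf    : ∀ i → i <φ φ → WFConf (conf i)
      step  : ∀ i → suc i <φ φ → conf i →Q conf (suc i)
      final : ∀ n → φ ≡ fin (suc n) → Normal (conf n)
  open Computation public

_≐_ : List ℕ → List ℕ → Set
A ≐ B = ∀ r → (r ∈ A) ⇔ (r ∈ B)

-- Every reduction step adds the same list of quantum variables to the register and to the
-- term: new(c) adds its fresh r to both, every other step changes neither, up to set equality.
-- For the β-rules this is where well-formedness enters: a linearly bound variable occurs in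
-- the body, so substituting for it loses none of the argument's quantum variables, and the
-- argument !N of a λ!x-redex is typed in a banged context, so N has none to lose.
-- Starting from QV₀ = Q(M₀) = ∅, induction along the computation gives QVᵢ = Q(Mᵢ).
module Submission where

open import Defs
open import Data.Nat using (ℕ)
open import Data.List using ([])
open import Relation.Binary.PropositionalEquality using (_≡_)

open import Algebra.Bundles using (CommutativeMonoid)
open import Data.Bool using (false; true)
open import Data.Empty using (⊥-elim)
open import Data.List using (List; _∷_; _++_; length; map)
open import Data.List.Membership.Propositional using (_∈_; _∉_)
open import Data.List.Membership.Propositional.Properties using (∈-++⁻)
open import Data.List.Relation.Binary.BagAndSetEquality using (_∼[_]_; set; commutativeMonoid)
open import Data.List.Relation.Binary.Subset.Propositional using (_⊆_)
open import Data.List.Relation.Binary.Subset.Propositional.Properties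
  using (⊆-refl; ⊆-trans; ⊆-reflexive; xs⊆xs++ys; xs⊆ys++xs; ++⁺; ++⁺ˡ)
open import Data.List.Relation.Unary.Any using (here; there)
open import Data.Maybe using (just)
open import Data.Nat using (zero; suc; _+_; _<_; s≤s; z≤n)
open import Data.Nat.Properties using (_≟_; <⇒≤)
open import Data.Product using (_×_; _,_; ∃-syntax)
open import Data.Sum using (_⊎_; inj₁; inj₂; [_,_]′)
import Data.Sum as Sum
open import Data.Unit using (tt)
open import Function using (_∘_)
open import Function.Bundles using (mk⇔)
open import Relation.Nullary using (yes; no)
open import Relation.Binary.PropositionalEquality using (_≢_; refl; sym; trans; cong; cong₂)
import Relation.Binary.PropositionalEquality as ≡

private
  module ListSet = CommutativeMonoid (commutativeMonoid set ℕ)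

open import Algebra.Properties.CommutativeSemigroup ListSet.commutativeSemigroup
  using (x∙yz≈y∙xz; xy∙z≈xz∙y)

mutual
  Q-rename : ∀ ρ M → Q (rename ρ M) ≡ Q M
  Q-rename ρ (var x) = refl
  Q-rename ρ (qvar s) = refl
  Q-rename ρ (bang M) = Q-rename ρ M
  Q-rename ρ c0 = refl
  Q-rename ρ c1 = refl
  Q-rename ρ (U i) = refl
  Q-rename ρ (new M) = Q-rename ρ M
  Q-rename ρ (app M N) = cong₂ _++_ (Q-rename ρ M) (Q-rename ρ N)
  Q-rename ρ (tup M N Ms) =
    cong₂ _++_ (Q-rename ρ M) (cong₂ _++_ (Q-rename ρ N) (Qs-renames ρ Ms))
  Q-rename ρ (lamB M) = Q-rename (ext ρ) M
  Q-rename ρ (lamV M) = Q-rename (ext ρ) M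
  Q-rename ρ (lamT k M) = Q-rename (extN (suc (suc k)) ρ) M

  Qs-renames : ∀ ρ Ms → Qs (renames ρ Ms) ≡ Qs Ms
  Qs-renames ρ [] = refl
  Qs-renames ρ (M ∷ Ms) = cong₂ _++_ (Q-rename ρ M) (Qs-renames ρ Ms)

Q-wk : ∀ b M → Q (wk b M) ≡ Q M
Q-wk b = Q-rename (b +_)

Q-extsN-+ : ∀ m σ x → Q (extsN m σ (m + x)) ≡ Q (σ x)
Q-extsN-+ zero σ x = refl
Q-extsN-+ (suc m) σ x = trans (Q-wk 1 (extsN m σ (m + x))) (Q-extsN-+ m σ x)

Q-bit : ∀ c → Q (bit c) ≡ []
Q-bit false = refl
Q-bit true = refl

Qs-map-qvar : ∀ rs → Qs (map qvar rs) ≡ rs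
Qs-map-qvar [] = refl
Qs-map-qvar (s ∷ rs) = cong (s ∷_) (Qs-map-qvar rs)

QTup-Q : ∀ {rs t} → QTup rs t → Q t ≡ rs
QTup-Q (one s) = refl
QTup-Q (many s₁ s₂ rs) = cong (λ ss → s₁ ∷ s₂ ∷ ss) (Qs-map-qvar rs)

infix 4 _Q⊆_

_Q⊆_ : (ℕ → Term) → List ℕ → Set
σ Q⊆ S = ∀ x → Q (σ x) ⊆ S

exts-Q⊆ : ∀ {σ S} → σ Q⊆ S → exts σ Q⊆ S
exts-Q⊆ σ⊆S zero ()
exts-Q⊆ {σ} σ⊆S (suc x) = ⊆-trans (⊆-reflexive (Q-wk 1 (σ x))) (σ⊆S x)

extsN-Q⊆ : ∀ m {σ S} → σ Q⊆ S → extsN m σ Q⊆ S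
extsN-Q⊆ zero σ⊆S = σ⊆S
extsN-Q⊆ (suc m) σ⊆S = exts-Q⊆ (extsN-Q⊆ m σ⊆S)

sub0-Q⊆ : ∀ N → sub0 N Q⊆ Q N
sub0-Q⊆ N zero = ⊆-refl
sub0-Q⊆ N (suc x) ()

patSub-Q⊆ : ∀ rs → patSub rs Q⊆ rs
patSub-Q⊆ (s ∷ rs) zero (here refl) = here refl
patSub-Q⊆ (s ∷ rs) (suc x) p = there (patSub-Q⊆ rs x p)

patSub-covers : ∀ rs {s} → s ∈ rs → ∃[ i ] i < length rs × s ∈ Q (patSub rs i)
patSub-covers (s ∷ rs) (here refl) = zero , s≤s z≤n , here refl
patSub-covers (s ∷ rs) (there p) with patSub-covers rs p
... | i , i<n , q = suc i , s≤s i<n , q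

++⁺-suffix : ∀ {X Y} A B {S : List ℕ} → X ⊆ A ++ S → Y ⊆ B ++ S → X ++ Y ⊆ (A ++ B) ++ S
++⁺-suffix {X} A B {S} X⊆ Y⊆ p with ∈-++⁻ X p
... | inj₁ q = ++⁺ˡ S (xs⊆xs++ys A B) (X⊆ q)
... | inj₂ q = ++⁺ˡ S (xs⊆ys++xs B A) (Y⊆ q)

mutual
  Q-subst-⊆ : ∀ {σ S} → σ Q⊆ S → ∀ M → Q (subst σ M) ⊆ Q M ++ S
  Q-subst-⊆ σ⊆S (var x) = σ⊆S x
  Q-subst-⊆ σ⊆S (qvar s) = xs⊆xs++ys _ _
  Q-subst-⊆ σ⊆S (bang M) = Q-subst-⊆ σ⊆S M
  Q-subst-⊆ σ⊆S c0 ()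
  Q-subst-⊆ σ⊆S c1 ()
  Q-subst-⊆ σ⊆S (U i) ()
  Q-subst-⊆ σ⊆S (new M) = Q-subst-⊆ σ⊆S M
  Q-subst-⊆ σ⊆S (app M N) = ++⁺-suffix (Q M) (Q N) (Q-subst-⊆ σ⊆S M) (Q-subst-⊆ σ⊆S N)
  Q-subst-⊆ σ⊆S (tup M N Ms) =
    ++⁺-suffix (Q M) (Q N ++ Qs Ms) (Q-subst-⊆ σ⊆S M)
      (++⁺-suffix (Q N) (Qs Ms) (Q-subst-⊆ σ⊆S N) (Qs-substs-⊆ σ⊆S Ms))
  Q-subst-⊆ σ⊆S (lamB M) = Q-subst-⊆ (exts-Q⊆ σ⊆S) M
  Q-subst-⊆ σ⊆S (lamV M) = Q-subst-⊆ (exts-Q⊆ σ⊆S) M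
  Q-subst-⊆ σ⊆S (lamT k M) = Q-subst-⊆ (extsN-Q⊆ (suc (suc k)) σ⊆S) M

  Qs-substs-⊆ : ∀ {σ S} → σ Q⊆ S → ∀ Ms → Qs (substs σ Ms) ⊆ Qs Ms ++ S
  Qs-substs-⊆ σ⊆S [] ()
  Qs-substs-⊆ σ⊆S (M ∷ Ms) = ++⁺-suffix (Q M) (Qs Ms) (Q-subst-⊆ σ⊆S M) (Qs-substs-⊆ σ⊆S Ms)

mutual
  Q⊆Q-subst : ∀ σ M → Q M ⊆ Q (subst σ M)
  Q⊆Q-subst σ (var x) ()
  Q⊆Q-subst σ (qvar s) = ⊆-refl
  Q⊆Q-subst σ (bang M) = Q⊆Q-subst σ M
  Q⊆Q-subst σ c0 ()
  Q⊆Q-subst σ c1 ()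
  Q⊆Q-subst σ (U i) ()
  Q⊆Q-subst σ (new M) = Q⊆Q-subst σ M
  Q⊆Q-subst σ (app M N) = ++⁺ (Q⊆Q-subst σ M) (Q⊆Q-subst σ N)
  Q⊆Q-subst σ (tup M N Ms) = ++⁺ (Q⊆Q-subst σ M) (++⁺ (Q⊆Q-subst σ N) (Qs⊆Qs-substs σ Ms))
  Q⊆Q-subst σ (lamB M) = Q⊆Q-subst (exts σ) M
  Q⊆Q-subst σ (lamV M) = Q⊆Q-subst (exts σ) M
  Q⊆Q-subst σ (lamT k M) = Q⊆Q-subst (extsN (suc (suc k)) σ) M

  Qs⊆Qs-substs : ∀ σ Ms → Qs Ms ⊆ Qs (substs σ Ms)
  Qs⊆Qs-substs σ [] ()
  Qs⊆Qs-substs σ (M ∷ Ms) = ++⁺ (Q⊆Q-subst σ M) (Qs⊆Qs-substs σ Ms)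

unr≢lin : ∀ {h} → Unr h → h ≢ just lin
unr≢lin none ()
unr≢lin bngd ()

splitH-lin : ∀ {h h₁ h₂} → SplitH h h₁ h₂ → h ≡ just lin
           → h₁ ≡ just lin ⊎ h₂ ≡ just lin
splitH-lin ll refl = inj₁ refl
splitH-lin lr refl = inj₂ refl

splitQ-true : ∀ {b b₁ b₂} → SplitQ b b₁ b₂ → b₁ ≡ true ⊎ b₂ ≡ true → b ≡ true
splitQ-true l _ = refl
splitQ-true r _ = refl
splitQ-true nn (inj₁ ())
splitQ-true nn (inj₂ ())

cl-extendN-+ : ∀ m {h Γ} n → cl (extendN m h Γ) (m + n) ≡ cl Γ n
cl-extendN-+ zero n = refl
cl-extendN-+ (suc m) n = cl-extendN-+ m n

cl-extendN-< : ∀ m {h Γ} i → i < m → cl (extendN m h Γ) i ≡ h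
cl-extendN-< (suc m) zero _ = refl
cl-extendN-< (suc m) (suc i) (s≤s i<m) = cl-extendN-< m i i<m

qv-extendN : ∀ m {h Γ} s → qv (extendN m h Γ) s ≡ qv Γ s
qv-extendN zero s = refl
qv-extendN (suc m) s = qv-extendN m s

⊢*-middle : ∀ {Γ} pre {P post} → Γ ⊢* (pre ++ P ∷ post) → ∃[ Δ ] Δ ⊢ P
⊢*-middle [] (wcons _ d _) = _ , d
⊢*-middle (M ∷ pre) (wcons _ _ ds) = ⊢*-middle pre ds

mutual
  Q-declared : ∀ {Γ M s} → Γ ⊢ M → s ∈ Q M → qv Γ s ≡ true
  Q-declared (axC _ k0) ()
  Q-declared (axC _ k1) ()
  Q-declared (axC _ (kU i)) ()
  Q-declared (axQ _ declared _) (here refl) = declared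
  Q-declared (axX _ _ _) ()
  Q-declared (prom _ d) = Q-declared d
  Q-declared (wnew d) = Q-declared d
  Q-declared {s = s} (wapp {M = M} (_ , split) d₁ d₂) p =
    splitQ-true (split s) (Sum.map (Q-declared d₁) (Q-declared d₂) (∈-++⁻ (Q M) p))
  Q-declared {s = s} (wtup {M = M} (_ , split) d ds) p =
    splitQ-true (split s) (Sum.map (Q-declared d) (Qs-declared ds) (∈-++⁻ (Q M) p))
  Q-declared (wlamB d) = Q-declared d
  Q-declared (wlamV d) = Q-declared d
  Q-declared {s = s} (wlamT {k = k} d) p =
    trans (sym (qv-extendN (suc (suc k)) s)) (Q-declared d p)

  Qs-declared : ∀ {Γ Ms s} → Γ ⊢* Ms → s ∈ Qs Ms → qv Γ s ≡ true
  Qs-declared (wnil _) ()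
  Qs-declared {s = s} (wcons {M = M} (_ , split) d ds) p =
    splitQ-true (split s) (Sum.map (Q-declared d) (Qs-declared ds) (∈-++⁻ (Q M) p))

promoted-Q-empty : ∀ {Γ N s} → Γ ⊢ bang N → s ∉ Q N
promoted-Q-empty (prom (_ , undeclared) d) p with () ← trans (sym (Q-declared d p)) (undeclared _)

mutual
  linear-Q⊆Q-subst : ∀ {Γ M x} σ → Γ ⊢ M → cl Γ x ≡ just lin
                   → Q (σ x) ⊆ Q (subst σ M)
  linear-Q⊆Q-subst σ (axC (unr , _) _) x-lin = ⊥-elim (unr≢lin (unr _) x-lin)
  linear-Q⊆Q-subst σ (axQ unr _ _) x-lin = ⊥-elim (unr≢lin (unr _) x-lin)
  linear-Q⊆Q-subst {x = x} σ (axX {n = n} _ others _) x-lin with x ≟ n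
  ... | yes refl = ⊆-refl
  ... | no x≢n = ⊥-elim (unr≢lin (others x x≢n) x-lin)
  linear-Q⊆Q-subst σ (prom (unr , _) _) x-lin = ⊥-elim (unr≢lin (unr _) x-lin)
  linear-Q⊆Q-subst σ (wnew d) x-lin = linear-Q⊆Q-subst σ d x-lin
  linear-Q⊆Q-subst {x = x} σ (wapp (split , _) d₁ d₂) x-lin with splitH-lin (split x) x-lin
  ... | inj₁ lin₁ = ⊆-trans (linear-Q⊆Q-subst σ d₁ lin₁) (xs⊆xs++ys _ _)
  ... | inj₂ lin₂ = ⊆-trans (linear-Q⊆Q-subst σ d₂ lin₂) (xs⊆ys++xs _ _)
  linear-Q⊆Q-subst {x = x} σ (wtup {M = M} (split , _) d ds) x-lin
    with splitH-lin (split x) x-lin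
  ... | inj₁ lin₁ = ⊆-trans (linear-Q⊆Q-subst σ d lin₁) (xs⊆xs++ys _ _)
  ... | inj₂ lin₂ = ⊆-trans (linear-Q⊆Qs-substs σ ds lin₂) (xs⊆ys++xs _ (Q (subst σ M)))
  linear-Q⊆Q-subst {x = x} σ (wlamB d) x-lin =
    ⊆-trans (⊆-reflexive (sym (Q-wk 1 (σ x)))) (linear-Q⊆Q-subst {x = suc x} (exts σ) d x-lin)
  linear-Q⊆Q-subst {x = x} σ (wlamV d) x-lin =
    ⊆-trans (⊆-reflexive (sym (Q-wk 1 (σ x)))) (linear-Q⊆Q-subst {x = suc x} (exts σ) d x-lin)
  linear-Q⊆Q-subst {x = x} σ (wlamT {k = k} d) x-lin =
    ⊆-trans (⊆-reflexive (sym (Q-extsN-+ (suc (suc k)) σ x)))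
            (linear-Q⊆Q-subst (extsN (suc (suc k)) σ) d
              (trans (cl-extendN-+ (suc (suc k)) x) x-lin))

  linear-Q⊆Qs-substs : ∀ {Γ Ms x} σ → Γ ⊢* Ms → cl Γ x ≡ just lin
                     → Q (σ x) ⊆ Qs (substs σ Ms)
  linear-Q⊆Qs-substs σ (wnil (unr , _)) x-lin = ⊥-elim (unr≢lin (unr _) x-lin)
  linear-Q⊆Qs-substs {x = x} σ (wcons (split , _) d ds) x-lin with splitH-lin (split x) x-lin
  ... | inj₁ lin₁ = ⊆-trans (linear-Q⊆Q-subst σ d lin₁) (xs⊆xs++ys _ _)
  ... | inj₂ lin₂ = ⊆-trans (linear-Q⊆Qs-substs σ ds lin₂) (xs⊆ys++xs _ _)

Q-subst-exact : ∀ {Γ M σ S} → Γ ⊢ M → σ Q⊆ S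
              → (∀ {s} → s ∈ S → ∃[ x ] cl Γ x ≡ just lin × s ∈ Q (σ x))
              → Q (subst σ M) ∼[ set ] Q M ++ S
Q-subst-exact {M = M} {σ} {S} d σ⊆S covered =
  mk⇔ (Q-subst-⊆ σ⊆S M) ([ Q⊆Q-subst σ M , S⊆ ]′ ∘ ∈-++⁻ (Q M))
  where
  S⊆ : S ⊆ Q (subst σ M)
  S⊆ p with covered p
  ... | x , x-lin , q = linear-Q⊆Q-subst σ d x-lin q

patSub-exact : ∀ {Γ k M rs t} → length rs ≡ suc (suc k) → QTup rs t
             → extendN (suc (suc k)) (just lin) Γ ⊢ M
             → Q (subst (patSub rs) M) ∼[ set ] Q M ++ Q t
patSub-exact {k = k} {rs = rs} len qt d rewrite QTup-Q qt =
  Q-subst-exact d (patSub-Q⊆ rs) covered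
  where
  covered : ∀ {s} → s ∈ rs → ∃[ x ] _ ≡ just lin × s ∈ Q (patSub rs x)
  covered p with patSub-covers rs p
  ... | i , i<n , q = i , cl-extendN-< (suc (suc k)) i (≡.subst (i <_) len i<n) , q

++-extendʳ : ∀ E Y B {X} → X ∼[ set ] E ++ Y → X ++ B ∼[ set ] E ++ (Y ++ B)
++-extendʳ E Y B h = ListSet.trans (ListSet.∙-congʳ h) (ListSet.assoc E Y B)

++-extendˡ : ∀ E A Y {X} → X ∼[ set ] E ++ Y → A ++ X ∼[ set ] E ++ (A ++ Y)
++-extendˡ E A Y h = ListSet.trans (ListSet.∙-congˡ h) (x∙yz≈y∙xz A E Y)

Qs-extend : ∀ E pre P post {P′} → Q P′ ∼[ set ] E ++ Q P
          → Qs (pre ++ P′ ∷ post) ∼[ set ] E ++ Qs (pre ++ P ∷ post)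
Qs-extend E [] P post h = ++-extendʳ E (Q P) (Qs post) h
Qs-extend E (M ∷ pre) P post h =
  ++-extendˡ E (Q M) (Qs (pre ++ P ∷ post)) (Qs-extend E pre P post h)

module _ (QM : QModel) where
  open QC QM

  step-extends : ∀ {C C′ Γ} → C ⟶ C′ → Γ ⊢ tm C
               → ∃[ E ] QV C′ ≡ E ++ QV C × Q (tm C′) ∼[ set ] E ++ Q (tm C)
  step-extends (Uq _ _) _ = [] , refl , ListSet.refl
  step-extends (rnew {c = c} {r = s} _) _ =
    s ∷ [] , refl , ListSet.reflexive (cong (s ∷_) (sym (Q-bit c)))
  step-extends (βV {N = N}) (wapp _ (wlamV d) _) =
    [] , refl , Q-subst-exact d (sub0-Q⊆ N) (λ p → zero , refl , p)
  step-extends (βT len qt) (wapp _ (wlamT d) _) = [] , refl , patSub-exact len qt d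
  step-extends (βB {N = N}) (wapp _ (wlamB d) dN) =
    [] , refl , Q-subst-exact d (sub0-Q⊆ N) (⊥-elim ∘ promoted-Q-empty dN)
  step-extends (ccLV {L = L} {M} {N}) _ rewrite Q-wk 1 L =
    [] , refl , ListSet.assoc (Q L) (Q M) (Q N)
  step-extends (ccLT {k = k} {L} {M} {N}) _ rewrite Q-wk (suc (suc k)) L =
    [] , refl , ListSet.assoc (Q L) (Q M) (Q N)
  step-extends (ccRV {L = L} {M} {N}) _ rewrite Q-wk 1 L =
    [] , refl , xy∙z≈xz∙y (Q M) (Q L) (Q N)
  step-extends (ccRT {k = k} {L} {M} {N}) _ rewrite Q-wk (suc (suc k)) L =
    [] , refl , xy∙z≈xz∙y (Q M) (Q L) (Q N)
  step-extends (appL {M = M} {N = N} s) (wapp _ d _) with step-extends s d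
  ... | E , QV-ext , Q-ext = E , QV-ext , ++-extendʳ E (Q M) (Q N) Q-ext
  step-extends (appR {M = M} {N = N} s) (wapp _ _ d) with step-extends s d
  ... | E , QV-ext , Q-ext = E , QV-ext , ++-extendˡ E (Q M) (Q N) Q-ext
  step-extends (tup1 {M = M} {N = N} {Ms = Ms} s) (wtup _ d _) with step-extends s d
  ... | E , QV-ext , Q-ext = E , QV-ext , ++-extendʳ E (Q M) (Q N ++ Qs Ms) Q-ext
  step-extends (tup2 {M = M} {N = N} {Ms = Ms} s) (wtup _ _ (wcons _ d _)) with step-extends s d
  ... | E , QV-ext , Q-ext =
    E , QV-ext , ++-extendˡ E (Q M) (Q N ++ Qs Ms) (++-extendʳ E (Q N) (Qs Ms) Q-ext)
  step-extends (tup3 {M = M} {N} {P = P} {pre = pre} {post} s) (wtup _ _ (wcons _ _ ds))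
    with _ , d ← ⊢*-middle pre ds | step-extends s d
  ... | E , QV-ext , Q-ext =
    E , QV-ext , ++-extendˡ E (Q M) (Q N ++ Qs (pre ++ P ∷ post))
                   (++-extendˡ E (Q N) (Qs (pre ++ P ∷ post)) (Qs-extend E pre P post Q-ext))
  step-extends (lamVξ s) (wlamV d) = step-extends s d
  step-extends (lamTξ s) (wlamT d) = step-extends s d

  <φ-pred : ∀ {i} φ → suc i <φ φ → i <φ φ
  <φ-pred (fin n) i+1<n = <⇒≤ i+1<n
  <φ-pred omega _ = tt

  QV∼Q : (K : Computation) → Q (tm (conf K 0)) ≡ [] → QV (conf K 0) ≡ []
       → ∀ i → i <φ φ K → QV (conf K i) ∼[ set ] Q (tm (conf K i))
  QV∼Q K Q₀ QV₀ zero _ = ListSet.reflexive (trans QV₀ (sym Q₀))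
  QV∼Q K Q₀ QV₀ (suc i) i+1<φ with step K i i+1<φ
  ... | (_ , _ , d) , _ , s with step-extends s d
  ... | E , QV-ext , Q-ext = begin
    QV (conf K (suc i))      ≡⟨ QV-ext ⟩
    E ++ QV (conf K i)       ≈⟨ ListSet.∙-congˡ (QV∼Q K Q₀ QV₀ i (<φ-pred (φ K) i+1<φ)) ⟩
    E ++ Q (tm (conf K i))   ≈⟨ ListSet.sym Q-ext ⟩
    Q (tm (conf K (suc i)))  ∎
    where open import Relation.Binary.Reasoning.Setoid ListSet.setoid

mainTheorem4 : (QM : QModel) (K : QC.Computation QM)
    → Q (QC.tm (QC.conf K 0)) ≡ []
    → QC.QV (QC.conf K 0) ≡ []
    → (i : ℕ) → QC._<φ_ QM i (QC.φ K)
    → QC.QV (QC.conf K i) ≐ Q (QC.tm (QC.conf K i))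
mainTheorem4 QM K Q₀ QV₀ i i<φ s = QV∼Q QM K Q₀ QV₀ i i<φ {s}
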